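{- Let $\mathcal{RR}_2$ be the set of partitions $\pi=(\lambda_1,\dots,\lambda_\nu)$ in which all parts are $>1$ and $\lambda_i-\lambda_{i+1}\ge2$ for all $1\le i\le \nu-1$ (including the empty partition). For nonempty such $\pi$ let \[\omega_{2,2}(\pi):=(\lambda_\nu-1)\prod_{i=1}^{\nu-1}(\lambda_i-\lambda_{i+1}-1),\] and let the weight of the empty partition be $1$. Let $\tilde{C}_{\ge0}$ be the set of all partitions with non-negative crank. Then \[\sum_{\pi\in\mathcal{RR}_2}\omega_{2,2}(\pi)\,q^{|\pi|}=\sum_{\pi\in\tilde{C}_{\ge0}}q^{|\pi|}.\]
   Context: A partition is a finite weakly decreasing sequence of positive integers; $|\pi|$ is the sum of its parts. The crank of a partition $\pi$ (Andrews–Garvan) is defined as follows: if $1$ is not a part of $\pi$, the crank is the largest part of $\pi$ (taken to be $0$ for the empty partition); otherwise, letting $\omega(\pi)$ be the number of parts equal to $1$ and $\mu(\pi)$ the number of parts of $\pi$ larger than $\omega(\pi)$, the crank is $\mu(\pi)-\omega(\pi)$. -}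

module Defs where

open import Data.Nat using (ℕ; zero; suc; _+_; _*_; _∸_; _≤_; _<_; _<?_; _≟_; _⊔_)
open import Data.Integer as ℤ using (ℤ; +_; _-_)
open import Data.List using (List; []; _∷_; length; filter; foldr; map)
open import Data.List.Relation.Unary.All using (All)
open import Data.List.Relation.Unary.Linked using (Linked)
open import Data.Product using (_×_)

IsPartition : List ℕ → Set
IsPartition π = All (λ x → 1 ≤ x) π × Linked (λ a b → b ≤ a) π

IsRR2 : List ℕ → Set
IsRR2 π = IsPartition π × All (λ x → 1 < x) π × Linked (λ a b → 2 + b ≤ a) π

ω22 : List ℕ → ℕ
ω22 [] = 1
ω22 (x ∷ []) = x ∸ 1
ω22 (a ∷ b ∷ r) = (a ∸ b ∸ 1) * ω22 (b ∷ r)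

numOnes : List ℕ → ℕ
numOnes π = length (filter (λ x → x ≟ 1) π)

numLarger : ℕ → List ℕ → ℕ
numLarger k π = length (filter (λ x → k <? x) π)

largestPart : List ℕ → ℕ
largestPart π = foldr _⊔_ 0 π

crank : List ℕ → ℤ
crank π with numOnes π
... | zero  = + largestPart π
... | suc w = + numLarger (suc w) π - + suc w

-- The proof is bijective.  ω₂,₂(l) is the number of lists t interlacing l
-- (l_{i+1} < tᵢ < lᵢ), and any interlaced list lies in RR₂, so the left side
-- counts the interlacing pairs (l, t) with |l| = n.  These correspond to pairs
-- (X, Y) of strictly decreasing lists of a common length k with |l| = |X| + |Y|.
-- A partition π with crank ≥ 0 is sent to such a pair: its w ones are set
-- aside, its leading parts ρⱼ > j + 1 give Xⱼ = ρⱼ - (j + 1) (a diagonal split),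
-- the other parts form a partition "bot" with parts in [2, k + 1], and crank ≥ 0
-- says exactly that w ≤ k; then (bot, w) is packed into k naturals (the
-- multiplicities of bot, the top one sharing an entry with w) read as the gaps
-- of Y.

module Submission where

open import Defs

open import Data.Nat
open import Data.Nat.Properties
open import Data.Nat.DivMod
open import Data.List
  using (List; []; _∷_; [_]; _++_; length; map; filter; replicate; reverse; applyUpTo; cartesianProductWith)
open import Data.List.Properties
  using (length-++; length-map; length-applyUpTo; ∷-injective; unfold-reverse; length-reverse; reverse-involutive;
         filter-accept; filter-reject; filter-none; filter-++; ++-identityʳ;
         map-∘; map-cong; map-id-local)
open import Data.Nat.ListAction using (sum)
open import Data.Nat.ListAction.Properties using (sum-++)
open import Data.Nat.Tactic.RingSolver using (solve-∀)
open import Data.List.Relation.Unary.All using (All; []; _∷_)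
import Data.List.Relation.Unary.All as All
import Data.List.Relation.Unary.All.Properties as All
open import Data.List.Relation.Unary.Any using (here; there)
open import Data.List.Relation.Unary.AllPairs using ([]; _∷_)
open import Data.List.Relation.Unary.Linked as Linked using (Linked; []; [-]; _∷_)
open import Data.List.Membership.Propositional using (_∈_)
open import Data.List.Membership.Propositional.Properties
  using (∈-++⁺ˡ; ∈-++⁺ʳ; ∈-++⁻; ∈-map⁺; ∈-map⁻; ∈-applyUpTo⁺; ∈-applyUpTo⁻;
         ∈-cartesianProductWith⁺; ∈-cartesianProductWith⁻)
open import Data.List.Membership.Propositional.Properties.WithK using (unique∧set⇒bag)
open import Data.List.Relation.Binary.BagAndSetEquality using (∼bag⇒↭)
open import Data.List.Relation.Binary.Permutation.Propositional.Properties using (↭-length)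
open import Data.List.Relation.Unary.Unique.Propositional using (Unique)
import Data.List.Relation.Unary.Unique.Propositional.Properties as Unique
import Data.Integer as ℤ
import Data.Integer.Properties as ℤ
open import Data.Product using (_×_; _,_; proj₁; proj₂)
open import Data.Sum using (_⊎_; inj₁; inj₂)
open import Data.Unit using (⊤; tt)
open import Data.Empty using (⊥; ⊥-elim)
open import Relation.Nullary using (yes; no)
open import Function.Base using (_∘_)
open import Function.Bundles using (_⇔_; mk⇔; Equivalence)
open import Relation.Binary.PropositionalEquality
  using (_≡_; refl; sym; trans; cong; cong₂; subst; module ≡-Reasoning)

unique-enumerations-length : {A : Set} {xs ys : List A} → Unique xs → Unique ys →
  (∀ {z} → (z ∈ xs) ⇔ (z ∈ ys)) → length xs ≡ length ys
unique-enumerations-length ux uy same = ↭-length (∼bag⇒↭ (unique∧set⇒bag ux uy same))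

length-cartesianProductWith : {A B C : Set} (f : A → B → C) (xs : List A) (ys : List B) →
  length (cartesianProductWith f xs ys) ≡ length xs * length ys
length-cartesianProductWith f [] ys = refl
length-cartesianProductWith f (x ∷ xs) ys = begin
  length (map (f x) ys ++ cartesianProductWith f xs ys)  ≡⟨ length-++ (map (f x) ys) ⟩
  length (map (f x) ys) + length (cartesianProductWith f xs ys)
    ≡⟨ cong₂ _+_ (length-map (f x) ys) (length-cartesianProductWith f xs ys) ⟩
  length ys + length xs * length ys  ∎
  where open ≡-Reasoning

sigmaList : {A B : Set} → List A → (A → List B) → List (A × B)
sigmaList [] g = []
sigmaList (x ∷ xs) g = map (x ,_) (g x) ++ sigmaList xs g

∈-sigmaList⁺ : {A B : Set} {xs : List A} {g : A → List B} {x : A} {y : B} →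
  x ∈ xs → y ∈ g x → (x , y) ∈ sigmaList xs g
∈-sigmaList⁺ {xs = x ∷ _} {g} (here refl) y∈ = ∈-++⁺ˡ (∈-map⁺ (x ,_) y∈)
∈-sigmaList⁺ {xs = x ∷ _} {g} (there x∈) y∈ = ∈-++⁺ʳ (map (x ,_) (g x)) (∈-sigmaList⁺ x∈ y∈)

∈-sigmaList⁻ : {A B : Set} (xs : List A) {g : A → List B} {x : A} {y : B} →
  (x , y) ∈ sigmaList xs g → x ∈ xs × y ∈ g x
∈-sigmaList⁻ (x ∷ xs) {g} p with ∈-++⁻ (map (x ,_) (g x)) p
... | inj₁ q with ∈-map⁻ (x ,_) q
...   | _ , y∈ , refl = here refl , y∈
∈-sigmaList⁻ (x ∷ xs) {g} p | inj₂ q with ∈-sigmaList⁻ xs q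
...   | x∈ , y∈ = there x∈ , y∈

length-sigmaList : {A B : Set} (xs : List A) (g : A → List B) →
  length (sigmaList xs g) ≡ sum (map (λ x → length (g x)) xs)
length-sigmaList [] g = refl
length-sigmaList (x ∷ xs) g = trans (length-++ (map (x ,_) (g x)))
  (cong₂ _+_ (length-map (x ,_) (g x)) (length-sigmaList xs g))

unique-sigmaList : {A B : Set} {xs : List A} {g : A → List B} →
  Unique xs → (∀ x → Unique (g x)) → Unique (sigmaList xs g)
unique-sigmaList {xs = []} [] ug = []
unique-sigmaList {xs = x ∷ xs} {g} (x∉xs ∷ uxs) ug =
  Unique.++⁺ (Unique.map⁺ (λ e → cong proj₂ e) (ug x)) (unique-sigmaList uxs ug) disjoint
  where
  disjoint : ∀ {v} → v ∈ map (x ,_) (g x) × v ∈ sigmaList xs g → ⊥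
  disjoint (p , q) with ∈-map⁻ (x ,_) p
  ... | _ , _ , refl = All.lookup x∉xs (proj₁ (∈-sigmaList⁻ xs q)) refl

-- head₀ reads the first entry of a list, with 0 for the empty list; this lets
-- "strictly/weakly decreasing" be stated one step at a time, the empty tail
-- acting as a 0 below the last entry.
head₀ : List ℕ → ℕ
head₀ [] = 0
head₀ (a ∷ _) = a

Strict : List ℕ → Set
Strict [] = ⊤
Strict (a ∷ r) = head₀ r < a × Strict r

Decreasing : List ℕ → Set
Decreasing [] = ⊤
Decreasing (a ∷ r) = head₀ r ≤ a × Decreasing r

linked⇒decreasing : ∀ {π} → Linked (λ a b → b ≤ a) π → Decreasing π
linked⇒decreasing [] = tt
linked⇒decreasing [-] = z≤n , tt
linked⇒decreasing (p ∷ l) = p , linked⇒decreasing l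

decreasing⇒linked : ∀ π → Decreasing π → Linked (λ a b → b ≤ a) π
decreasing⇒linked [] _ = []
decreasing⇒linked (a ∷ []) _ = [-]
decreasing⇒linked (a ∷ b ∷ π) (h , d) = h ∷ decreasing⇒linked (b ∷ π) d

decreasing-bounded : ∀ a r → Decreasing (a ∷ r) → All (_≤ a) r
decreasing-bounded a [] _ = []
decreasing-bounded a (b ∷ r) (b≤a , d) =
  b≤a ∷ All.map (λ c≤b → ≤-trans c≤b b≤a) (decreasing-bounded b r d)

head₀-bounded : ∀ {B} l → All (_≤ B) l → head₀ l ≤ B
head₀-bounded [] _ = z≤n
head₀-bounded (a ∷ l) (a≤B ∷ _) = a≤B

strict-length : ∀ X → Strict X → length X ≤ head₀ X
strict-length [] _ = z≤n
strict-length (a ∷ X) (h , s) = ≤-trans (s≤s (strict-length X s)) h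

Interlaces : List ℕ → List ℕ → Set
Interlaces [] [] = ⊤
Interlaces [] (_ ∷ _) = ⊥
Interlaces (_ ∷ _) [] = ⊥
Interlaces (a ∷ r) (t ∷ ts) = head₀ r < t × t < a × Interlaces r ts

interlaces⇒gap : ∀ l t → Interlaces l t → Linked (λ a b → 2 + b ≤ a) l
interlaces⇒gap [] [] _ = []
interlaces⇒gap (a ∷ []) (t ∷ ts) _ = [-]
interlaces⇒gap (a ∷ b ∷ r) (t ∷ ts) (b<t , t<a , it) = ≤-trans (s≤s b<t) t<a ∷ interlaces⇒gap (b ∷ r) ts it

interlaces⇒big : ∀ l t → Interlaces l t → All (1 <_) l
interlaces⇒big [] [] _ = []
interlaces⇒big (a ∷ r) (t ∷ ts) (r<t , t<a , it) =
  ≤-trans (s≤s (≤-trans (s≤s z≤n) r<t)) t<a ∷ interlaces⇒big r ts it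

interlaces⇒RR2 : ∀ l t → Interlaces l t → IsRR2 l
interlaces⇒RR2 l t it =
  (All.map (≤-trans (n≤1+n 1)) big , Linked.map (≤-trans (m≤n+m _ 2)) gap) , big , gap
  where
  big : All (1 <_) l
  big = interlaces⇒big l t it
  gap : Linked (λ a b → 2 + b ≤ a) l
  gap = interlaces⇒gap l t it

between : ℕ → ℕ → List ℕ
between b a = applyUpTo (suc b +_) (a ∸ suc b)

∈-between⁻ : ∀ {t} b a → t ∈ between b a → b < t × t < a
∈-between⁻ b a p with ∈-applyUpTo⁻ (suc b +_) p
... | i , i<n , refl = s≤s (m≤m+n b i) , (begin-strict
  suc b + i               <⟨ +-monoʳ-< (suc b) i<n ⟩
  suc b + (a ∸ suc b)     ≡⟨ m+[n∸m]≡n b<a ⟩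
  a                       ∎)
  where
  open ≤-Reasoning
  b<a : suc b ≤ a
  b<a = <⇒≤ (m∸n≢0⇒n<m (λ e → <-irrefl (sym e) (≤-trans (s≤s z≤n) i<n)))

∈-between⁺ : ∀ {t} b a → b < t → t < a → t ∈ between b a
∈-between⁺ {t} b a b<t t<a =
  subst (_∈ between b a) (m+[n∸m]≡n b<t) (∈-applyUpTo⁺ (suc b +_) (∸-monoˡ-< t<a b<t))

unique-between : ∀ b a → Unique (between b a)
unique-between b a =
  Unique.applyUpTo⁺₁ (suc b +_) (a ∸ suc b) (λ i<j _ e → <-irrefl (+-cancelˡ-≡ (suc b) _ _ e) i<j)

interlacings : List ℕ → List (List ℕ)
interlacings [] = [ [] ]
interlacings (a ∷ r) = cartesianProductWith _∷_ (between (head₀ r) a) (interlacings r)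

∈-interlacings⁻ : ∀ l {t} → t ∈ interlacings l → Interlaces l t
∈-interlacings⁻ [] (here refl) = tt
∈-interlacings⁻ (a ∷ r) p with ∈-cartesianProductWith⁻ _∷_ (between (head₀ r) a) (interlacings r) p
... | t , ts , t∈ , ts∈ , refl with ∈-between⁻ (head₀ r) a t∈
...   | r<t , t<a = r<t , t<a , ∈-interlacings⁻ r ts∈

∈-interlacings⁺ : ∀ l t → Interlaces l t → t ∈ interlacings l
∈-interlacings⁺ [] [] _ = here refl
∈-interlacings⁺ (a ∷ r) (t ∷ ts) (r<t , t<a , it) =
  ∈-cartesianProductWith⁺ _∷_ (∈-between⁺ (head₀ r) a r<t t<a) (∈-interlacings⁺ r ts it)

unique-interlacings : ∀ l → Unique (interlacings l)
unique-interlacings [] = [] ∷ []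
unique-interlacings (a ∷ r) =
  Unique.cartesianProductWith⁺ _∷_ ∷-injective (unique-between (head₀ r) a) (unique-interlacings r)

length-interlacings : ∀ l → length (interlacings l) ≡ ω22 l
length-interlacings [] = refl
length-interlacings (a ∷ r) = begin
  length (cartesianProductWith _∷_ (between (head₀ r) a) (interlacings r))
    ≡⟨ length-cartesianProductWith _∷_ (between (head₀ r) a) (interlacings r) ⟩
  length (between (head₀ r) a) * length (interlacings r)
    ≡⟨ cong₂ _*_ (length-applyUpTo (suc (head₀ r) +_) (a ∸ suc (head₀ r))) (length-interlacings r) ⟩
  (a ∸ suc (head₀ r)) * ω22 r
    ≡⟨ first-factor r ⟩
  ω22 (a ∷ r) ∎
  where
  open ≡-Reasoning
  first-factor : ∀ r → (a ∸ suc (head₀ r)) * ω22 r ≡ ω22 (a ∷ r)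
  first-factor [] = *-identityʳ (a ∸ 1)
  first-factor (b ∷ r) = cong (_* ω22 (b ∷ r)) (trans (cong (a ∸_) (+-comm 1 b)) (sym (∸-+-assoc a b 1)))

-- Interlacing pairs (l, t) of length k correspond to pairs (X, Y) of strictly
-- decreasing lists of length k:  lᵢ = Xᵢ + Yᵢ  and  tᵢ = X_{i+1} + Yᵢ.
-- This splits ∑ |l| over interlacing pairs as |X| + |Y|.
interlace : List ℕ → List ℕ → List ℕ × List ℕ
interlace (a ∷ X) (b ∷ Y) = (a + b ∷ proj₁ (interlace X Y)) , (head₀ X + b ∷ proj₂ (interlace X Y))
interlace _ _ = [] , []

deinterlace : List ℕ → List ℕ → List ℕ × List ℕ
deinterlace (l ∷ ls) (t ∷ ts) =
  let (X , Y) = deinterlace ls ts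
      b = t ∸ head₀ X
  in (l ∸ b ∷ X) , (b ∷ Y)
deinterlace _ _ = [] , []

head₀-interlace : ∀ X Y → length X ≡ length Y →
  head₀ (proj₁ (interlace X Y)) ≡ head₀ X + head₀ Y
head₀-interlace [] [] e = refl
head₀-interlace (a ∷ X) (b ∷ Y) e = refl

interlace-interlaces : ∀ X Y → length X ≡ length Y → Strict X → Strict Y →
  Interlaces (proj₁ (interlace X Y)) (proj₂ (interlace X Y))
interlace-interlaces [] [] e sX sY = tt
interlace-interlaces (a ∷ X) (b ∷ Y) e (Xa , sX) (Yb , sY) =
  subst (_< head₀ X + b) (sym (head₀-interlace X Y (suc-injective e))) (+-monoʳ-< (head₀ X) Yb)
  , +-monoˡ-< b Xa
  , interlace-interlaces X Y (suc-injective e) sX sY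

deinterlace-interlace : ∀ X Y → length X ≡ length Y →
  deinterlace (proj₁ (interlace X Y)) (proj₂ (interlace X Y)) ≡ (X , Y)
deinterlace-interlace [] [] e = refl
deinterlace-interlace (a ∷ X) (b ∷ Y) e
  rewrite deinterlace-interlace X Y (suc-injective e) | m+n∸m≡n (head₀ X) b | m+n∸n≡m a b = refl

sum-interlace : ∀ X Y → length X ≡ length Y → sum (proj₁ (interlace X Y)) ≡ sum X + sum Y
sum-interlace [] [] e = refl
sum-interlace (a ∷ X) (b ∷ Y) e rewrite sum-interlace X Y (suc-injective e) =
  rearrange a b (sum X) (sum Y)
  where
  rearrange : ∀ a b x y → a + b + (x + y) ≡ a + x + (b + y)
  rearrange = solve-∀

record Deinterlaced (l t : List ℕ) : Set where
  field
    interlace-deinterlace : interlace (proj₁ (deinterlace l t)) (proj₂ (deinterlace l t)) ≡ (l , t)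
    length-X : length (proj₁ (deinterlace l t)) ≡ length l
    length-Y : length (proj₂ (deinterlace l t)) ≡ length l
    strict-X : Strict (proj₁ (deinterlace l t))
    strict-Y : Strict (proj₂ (deinterlace l t))
    head₀-sum : head₀ (proj₁ (deinterlace l t)) + head₀ (proj₂ (deinterlace l t)) ≡ head₀ l

deinterlace-correct : ∀ l t → Interlaces l t → Deinterlaced l t
deinterlace-correct [] [] _ = record
  { interlace-deinterlace = refl ; length-X = refl ; length-Y = refl
  ; strict-X = tt ; strict-Y = tt ; head₀-sum = refl }
deinterlace-correct (l ∷ ls) (t ∷ ts) (ls<t , t<l , it) = record
  { interlace-deinterlace = rebuild
  ; length-X = cong suc length-X
  ; length-Y = cong suc length-Y
  ; strict-X = X<l∸b , strict-X
  ; strict-Y = Y<b , strict-Y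
  ; head₀-sum = m∸n+n≡m b≤l }
  where
  open Deinterlaced (deinterlace-correct ls ts it)
  X : List ℕ
  X = proj₁ (deinterlace ls ts)
  Y : List ℕ
  Y = proj₂ (deinterlace ls ts)
  b : ℕ
  b = t ∸ head₀ X
  X<t : head₀ X < t
  X<t = ≤-<-trans (subst (head₀ X ≤_) head₀-sum (m≤m+n (head₀ X) (head₀ Y))) ls<t
  b≤l : b ≤ l
  b≤l = ≤-trans (m∸n≤m t (head₀ X)) (<⇒≤ t<l)
  rebuild : interlace (l ∸ b ∷ X) (b ∷ Y) ≡ (l ∷ ls , t ∷ ts)
  rebuild rewrite interlace-deinterlace | m∸n+n≡m b≤l | m+[n∸m]≡n (<⇒≤ X<t) = refl
  X<l∸b : head₀ X < l ∸ b
  X<l∸b = m+n≤o⇒m≤o∸n (suc (head₀ X)) (subst (_≤ l) (sym (cong suc (m+[n∸m]≡n (<⇒≤ X<t)))) t<l)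
  Y<b : head₀ Y < b
  Y<b = m+n≤o⇒m≤o∸n (suc (head₀ Y))
    (subst (λ z → suc z ≤ t) (trans (sym head₀-sum) (+-comm (head₀ X) (head₀ Y))) ls<t)

-- Gap coding: a strictly decreasing list Y of positive integers is determined
-- by its gaps  yᵢ = Yᵢ - Y_{i+1} - 1 ≥ 0, and conversely every list y of
-- naturals arises, via  Yᵢ = ∑_{j ≥ i} (yⱼ + 1).
gaps : List ℕ → List ℕ
gaps [] = []
gaps (a ∷ r) = a ∸ suc (head₀ r) ∷ gaps r

ungaps : List ℕ → List ℕ
ungaps [] = []
ungaps (c ∷ cs) = suc c + head₀ (ungaps cs) ∷ ungaps cs

strict-ungaps : ∀ y → Strict (ungaps y)
strict-ungaps [] = tt
strict-ungaps (c ∷ cs) = s≤s (m≤n+m _ c) , strict-ungaps cs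

gaps-ungaps : ∀ y → gaps (ungaps y) ≡ y
gaps-ungaps [] = refl
gaps-ungaps (c ∷ cs) rewrite gaps-ungaps cs | m+n∸n≡m c (head₀ (ungaps cs)) = refl

ungaps-gaps : ∀ Y → Strict Y → ungaps (gaps Y) ≡ Y
ungaps-gaps [] _ = refl
ungaps-gaps (a ∷ r) (r<a , s) rewrite ungaps-gaps r s =
  cong (_∷ r) (trans (sym (+-suc (a ∸ suc (head₀ r)) (head₀ r))) (m∸n+n≡m r<a))

length-gaps : ∀ Y → length (gaps Y) ≡ length Y
length-gaps [] = refl
length-gaps (a ∷ r) = cong suc (length-gaps r)

length-ungaps : ∀ y → length (ungaps y) ≡ length y
length-ungaps [] = refl
length-ungaps (a ∷ r) = cong suc (length-ungaps r)

head₀-ungaps : ∀ y → head₀ (ungaps y) ≡ sum (map suc y)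
head₀-ungaps [] = refl
head₀-ungaps (c ∷ cs) = cong (suc c +_) (head₀-ungaps cs)

-- weighted i y = ∑ⱼ (i + 1 + j)(yⱼ + 1); for i = 0 this is the size of ungaps y.
weighted : ℕ → List ℕ → ℕ
weighted i [] = 0
weighted i (c ∷ cs) = suc i * suc c + weighted (suc i) cs

weighted-ungaps : ∀ i y → weighted i y ≡ i * sum (map suc y) + sum (ungaps y)
weighted-ungaps i [] = sym (trans (+-identityʳ (i * 0)) (*-zeroʳ i))
weighted-ungaps i (c ∷ cs) rewrite weighted-ungaps (suc i) cs | head₀-ungaps cs =
  rearrange i c (sum (map suc cs)) (sum (ungaps cs))
  where
  rearrange : ∀ i c s u → suc i * suc c + (suc i * s + u) ≡ i * (suc c + s) + (suc c + s + u)
  rearrange = solve-∀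

sum-ungaps : ∀ y → sum (ungaps y) ≡ weighted 0 y
sum-ungaps y = sym (weighted-ungaps 0 y)

weighted-snoc : ∀ i l c → weighted i (l ++ [ c ]) ≡ weighted i l + (i + suc (length l)) * suc c
weighted-snoc i [] c = rearrange i c
  where
  rearrange : ∀ i c → suc i * suc c + 0 ≡ 0 + (i + 1) * suc c
  rearrange = solve-∀
weighted-snoc i (a ∷ l) c rewrite weighted-snoc (suc i) l c | +-suc i (suc (length l)) =
  sym (+-assoc (suc i * suc a) (weighted (suc i) l) _)

staircase : ℕ → ℕ → ℕ
staircase i zero = 0
staircase i (suc k) = suc i + staircase (suc i) k

staircase-snoc : ∀ i k → staircase i (suc k) ≡ staircase i k + (i + suc k)
staircase-snoc i zero = trans (+-identityʳ (suc i)) (sym (+-comm i 1))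
staircase-snoc i (suc k) rewrite staircase-snoc (suc i) k | +-suc i (suc k) =
  sym (+-assoc (suc i) (staircase (suc i) k) _)

sum-replicate : ∀ c v → sum (replicate c v) ≡ c * v
sum-replicate zero v = refl
sum-replicate (suc c) v = cong (v +_) (sum-replicate c v)

-- Multiplicity coding: (c_k, …, c₁) ↦ the weakly decreasing list with c_j
-- copies of j + 1, for j = k, …, 1; i.e. the partitions with parts in [2, k+1].
fromMultiplicities : List ℕ → List ℕ
fromMultiplicities [] = []
fromMultiplicities (c ∷ cs) = replicate c (suc (suc (length cs))) ++ fromMultiplicities cs

-- Listed by increasing part size, the multiplicities weighted by the part size
-- give the size of the partition; the "+ 1"s contribute 2 + 3 + ⋯ + (k + 1).
weighted-reverse : ∀ ms →
  weighted 1 (reverse ms) ≡ sum (fromMultiplicities ms) + staircase 1 (length ms)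
weighted-reverse [] = refl
weighted-reverse (c ∷ cs)
  rewrite unfold-reverse c cs | weighted-snoc 1 (reverse cs) c | weighted-reverse cs
        | length-reverse cs | sum-++ (replicate c (suc (suc (length cs)))) (fromMultiplicities cs)
        | sum-replicate c (suc (suc (length cs))) | staircase-snoc 1 (length cs) =
  rearrange c (length cs) (sum (fromMultiplicities cs)) (staircase 1 (length cs))
  where
  rearrange : ∀ c n s t → s + t + suc (suc n) * suc c ≡ c * suc (suc n) + s + (t + suc (suc n))
  rearrange = solve-∀

leadingCount : ℕ → List ℕ → ℕ
leadingCount v [] = 0
leadingCount v (x ∷ xs) with x ≟ v
... | yes _ = suc (leadingCount v xs)
... | no _ = 0

dropLeading : ℕ → List ℕ → List ℕ
dropLeading v [] = []
dropLeading v (x ∷ xs) with x ≟ v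
... | yes _ = dropLeading v xs
... | no _ = x ∷ xs

leading-split : ∀ v L → replicate (leadingCount v L) v ++ dropLeading v L ≡ L
leading-split v [] = refl
leading-split v (x ∷ xs) with x ≟ v
... | yes refl = cong (x ∷_) (leading-split v xs)
... | no _ = refl

dropLeading-all : ∀ {P : ℕ → Set} v L → All P L → All P (dropLeading v L)
dropLeading-all v [] a = a
dropLeading-all v (x ∷ xs) (p ∷ ps) with x ≟ v
... | yes _ = dropLeading-all v xs ps
... | no _ = p ∷ ps

dropLeading-decreasing : ∀ v L → Decreasing L → Decreasing (dropLeading v L)
dropLeading-decreasing v [] d = d
dropLeading-decreasing v (x ∷ xs) d with x ≟ v
... | yes _ = dropLeading-decreasing v xs (proj₂ d)
... | no _ = d

dropLeading-below : ∀ v L → Decreasing L → All (_≤ v) L → All (_< v) (dropLeading v L)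
dropLeading-below v [] d a = []
dropLeading-below v (x ∷ xs) d (x≤v ∷ ps) with x ≟ v
... | yes _ = dropLeading-below v xs (proj₂ d) ps
... | no x≢v = x<v ∷ All.map (λ q → ≤-<-trans q x<v) (decreasing-bounded x xs d)
  where x<v = ≤∧≢⇒< x≤v x≢v

leadingCount-absent : ∀ v L → All (_< v) L → leadingCount v L ≡ 0
leadingCount-absent v [] _ = refl
leadingCount-absent v (x ∷ xs) (x<v ∷ _) with x ≟ v
... | yes refl = ⊥-elim (<-irrefl refl x<v)
... | no _ = refl

dropLeading-absent : ∀ v L → All (_< v) L → dropLeading v L ≡ L
dropLeading-absent v [] _ = refl
dropLeading-absent v (x ∷ xs) (x<v ∷ _) with x ≟ v
... | yes refl = ⊥-elim (<-irrefl refl x<v)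
... | no _ = refl

leadingCount-replicate : ∀ v c L → leadingCount v (replicate c v ++ L) ≡ c + leadingCount v L
leadingCount-replicate v zero L = refl
leadingCount-replicate v (suc c) L with v ≟ v
... | yes _ = cong suc (leadingCount-replicate v c L)
... | no v≢v = ⊥-elim (v≢v refl)

dropLeading-replicate : ∀ v c L → dropLeading v (replicate c v ++ L) ≡ dropLeading v L
dropLeading-replicate v zero L = refl
dropLeading-replicate v (suc c) L with v ≟ v
... | yes _ = dropLeading-replicate v c L
... | no v≢v = ⊥-elim (v≢v refl)

decreasing-replicate : ∀ c v L → Decreasing L → head₀ L ≤ v → Decreasing (replicate c v ++ L)
decreasing-replicate zero v L d h = d
decreasing-replicate (suc zero) v L d h = h , d
decreasing-replicate (suc (suc c)) v L d h = ≤-refl , decreasing-replicate (suc c) v L d h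

multiplicities : ℕ → List ℕ → List ℕ
multiplicities zero L = []
multiplicities (suc n) L =
  leadingCount (suc (suc n)) L ∷ multiplicities n (dropLeading (suc (suc n)) L)

length-multiplicities : ∀ n L → length (multiplicities n L) ≡ n
length-multiplicities zero L = refl
length-multiplicities (suc n) L = cong suc (length-multiplicities n _)

fromMultiplicities-multiplicities : ∀ n L → Decreasing L → All (2 ≤_) L → All (_≤ suc n) L →
  fromMultiplicities (multiplicities n L) ≡ L
fromMultiplicities-multiplicities zero [] _ _ _ = refl
fromMultiplicities-multiplicities zero (x ∷ L) _ (2≤x ∷ _) (x≤1 ∷ _) = ⊥-elim (<-irrefl refl (≤-trans 2≤x x≤1))
fromMultiplicities-multiplicities (suc n) L d two bound
  rewrite length-multiplicities n (dropLeading (suc (suc n)) L)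
        | fromMultiplicities-multiplicities n (dropLeading (suc (suc n)) L)
            (dropLeading-decreasing _ L d) (dropLeading-all _ L two)
            (All.map ≤-pred (dropLeading-below _ L d bound))
  = leading-split (suc (suc n)) L

fromMultiplicities-≥2 : ∀ ms → All (2 ≤_) (fromMultiplicities ms)
fromMultiplicities-≥2 [] = []
fromMultiplicities-≥2 (c ∷ cs) = All.++⁺ (All.replicate⁺ c (s≤s (s≤s z≤n))) (fromMultiplicities-≥2 cs)

fromMultiplicities-bounded : ∀ ms → All (_≤ suc (length ms)) (fromMultiplicities ms)
fromMultiplicities-bounded [] = []
fromMultiplicities-bounded (c ∷ cs) =
  All.++⁺ (All.replicate⁺ c ≤-refl) (All.map (λ p → ≤-trans p (n≤1+n _)) (fromMultiplicities-bounded cs))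

fromMultiplicities-decreasing : ∀ ms → Decreasing (fromMultiplicities ms)
fromMultiplicities-decreasing [] = tt
fromMultiplicities-decreasing (c ∷ cs) =
  decreasing-replicate c _ (fromMultiplicities cs) (fromMultiplicities-decreasing cs)
    (≤-trans (head₀-bounded _ (fromMultiplicities-bounded cs)) (n≤1+n _))

multiplicities-fromMultiplicities : ∀ ms → multiplicities (length ms) (fromMultiplicities ms) ≡ ms
multiplicities-fromMultiplicities [] = refl
multiplicities-fromMultiplicities (c ∷ cs)
  rewrite leadingCount-replicate (suc (suc (length cs))) c (fromMultiplicities cs)
        | dropLeading-replicate (suc (suc (length cs))) c (fromMultiplicities cs)
        | leadingCount-absent _ (fromMultiplicities cs) (All.map s≤s (fromMultiplicities-bounded cs))
        | dropLeading-absent _ (fromMultiplicities cs) (All.map s≤s (fromMultiplicities-bounded cs))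
        | multiplicities-fromMultiplicities cs | +-identityʳ c = refl

Encodable : ℕ → List ℕ → ℕ → Set
Encodable k bot w = Decreasing bot × All (2 ≤_) bot × All (_≤ suc k) bot × w ≤ k

-- Such data is encoded by a list y of k naturals: y₀ = w + (k+1)·(number of
-- parts k+1), and y_j (1 ≤ j < k) is the number of parts j + 1.  Since w ≤ k,
-- division by k + 1 recovers both numbers packed into y₀.
encode : ℕ → List ℕ → ℕ → List ℕ
encode zero bot w = []
encode (suc k) bot w =
  w + leadingCount (suc (suc k)) bot * suc (suc k)
  ∷ reverse (multiplicities k (dropLeading (suc (suc k)) bot))

decode : ℕ → List ℕ → List ℕ × ℕ
decode zero y = [] , 0
decode (suc k) [] = [] , 0
decode (suc k) (c ∷ rest) =
  replicate (c / suc (suc k)) (suc (suc k)) ++ fromMultiplicities (reverse rest) , c % suc (suc k)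

length-encode : ∀ k bot w → length (encode k bot w) ≡ k
length-encode zero bot w = refl
length-encode (suc k) bot w =
  cong suc (trans (length-reverse (multiplicities k _)) (length-multiplicities k _))

div-packed : ∀ w q v .{{_ : NonZero v}} → w < v → (w + q * v) / v ≡ q
div-packed w q v w<v = begin
  (w + q * v) / v    ≡⟨ +-distrib-/ w (q * v) no-carry ⟩
  w / v + q * v / v  ≡⟨ cong₂ _+_ (m<n⇒m/n≡0 w<v) (m*n/n≡m q v) ⟩
  q                  ∎
  where
  open ≡-Reasoning
  no-carry : w % v + q * v % v < v
  no-carry = subst (_< v) (sym (trans (cong₂ _+_ (m<n⇒m%n≡m w<v) (m*n%n≡0 q v)) (+-identityʳ w))) w<v

mod-packed : ∀ w q v .{{_ : NonZero v}} → w < v → (w + q * v) % v ≡ w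
mod-packed w q v w<v = trans ([m+kn]%n≡m%n w q v) (m<n⇒m%n≡m w<v)

rest-bounded : ∀ k bot → Decreasing bot → All (_≤ suc (suc k)) bot →
  All (_≤ suc k) (dropLeading (suc (suc k)) bot)
rest-bounded k bot d bound = All.map ≤-pred (dropLeading-below _ bot d bound)

decode-encode : ∀ k bot w → Encodable k bot w → decode k (encode k bot w) ≡ (bot , w)
decode-encode zero [] zero _ = refl
decode-encode zero (x ∷ bot) w (_ , 2≤x ∷ _ , x≤1 ∷ _ , _) = ⊥-elim (<-irrefl refl (≤-trans 2≤x x≤1))
decode-encode (suc k) bot w (d , two , bound , w≤k)
  rewrite div-packed w (leadingCount (suc (suc k)) bot) (suc (suc k)) (s≤s w≤k)
        | mod-packed w (leadingCount (suc (suc k)) bot) (suc (suc k)) (s≤s w≤k)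
        | reverse-involutive (multiplicities k (dropLeading (suc (suc k)) bot))
        | fromMultiplicities-multiplicities k (dropLeading (suc (suc k)) bot)
            (dropLeading-decreasing _ bot d) (dropLeading-all _ bot two) (rest-bounded k bot d bound)
        | leading-split (suc (suc k)) bot = refl

decoded-below : ∀ k c rest → length (c ∷ rest) ≡ suc k →
  All (_< suc (suc k)) (fromMultiplicities (reverse rest))
decoded-below k c rest e =
  All.map (λ p → s≤s (subst (λ n → _ ≤ suc n) (trans (length-reverse rest) (suc-injective e)) p))
    (fromMultiplicities-bounded (reverse rest))

encode-decode : ∀ k y → length y ≡ k → encode k (proj₁ (decode k y)) (proj₂ (decode k y)) ≡ y
encode-decode zero [] _ = refl
encode-decode (suc k) (c ∷ rest) e
  rewrite leadingCount-replicate (suc (suc k)) (c / suc (suc k)) (fromMultiplicities (reverse rest))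
        | dropLeading-replicate (suc (suc k)) (c / suc (suc k)) (fromMultiplicities (reverse rest))
        | leadingCount-absent (suc (suc k)) _ (decoded-below k c rest e)
        | dropLeading-absent (suc (suc k)) _ (decoded-below k c rest e)
        | +-identityʳ (c / suc (suc k))
  = cong₂ _∷_ (sym (m≡m%n+[m/n]*n c (suc (suc k)))) (begin
      reverse (multiplicities k (fromMultiplicities (reverse rest)))
        ≡⟨ cong (λ n → reverse (multiplicities n (fromMultiplicities (reverse rest)))) (sym length-rest) ⟩
      reverse (multiplicities (length (reverse rest)) (fromMultiplicities (reverse rest)))
        ≡⟨ cong reverse (multiplicities-fromMultiplicities (reverse rest)) ⟩
      reverse (reverse rest)
        ≡⟨ reverse-involutive rest ⟩
      rest ∎)
  where
  open ≡-Reasoning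
  length-rest : length (reverse rest) ≡ k
  length-rest = trans (length-reverse rest) (suc-injective e)

decode-encodable : ∀ k y → length y ≡ k → Encodable k (proj₁ (decode k y)) (proj₂ (decode k y))
decode-encodable zero [] _ = tt , [] , [] , z≤n
decode-encodable (suc k) (c ∷ rest) e =
    decreasing-replicate (c / suc (suc k)) (suc (suc k)) (fromMultiplicities (reverse rest))
      (fromMultiplicities-decreasing (reverse rest)) (head₀-bounded _ below)
  , All.++⁺ (All.replicate⁺ _ (s≤s (s≤s z≤n))) (fromMultiplicities-≥2 (reverse rest))
  , All.++⁺ (All.replicate⁺ _ ≤-refl) below
  , ≤-pred (m%n<n c (suc (suc k)))
  where
  below : All (_≤ suc (suc k)) (fromMultiplicities (reverse rest))
  below = All.map <⇒≤ (decoded-below k c rest e)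

sum-ungaps-encode : ∀ k bot w → Encodable k bot w →
  sum (ungaps (encode k bot w)) ≡ staircase 0 k + sum bot + w
sum-ungaps-encode zero [] zero _ = refl
sum-ungaps-encode zero (x ∷ bot) w (_ , 2≤x ∷ _ , x≤1 ∷ _ , _) = ⊥-elim (<-irrefl refl (≤-trans 2≤x x≤1))
sum-ungaps-encode (suc k) bot w (d , two , bound , w≤k) = begin
  sum (ungaps (c ∷ reverse ms))                                ≡⟨ sum-ungaps (c ∷ reverse ms) ⟩
  1 * suc c + weighted 1 (reverse ms)                          ≡⟨ cong (1 * suc c +_) (weighted-reverse ms) ⟩
  1 * suc c + (sum (fromMultiplicities ms) + staircase 1 (length ms))
    ≡⟨ cong₂ (λ u n → 1 * suc c + (sum u + staircase 1 n)) restored (length-multiplicities k _) ⟩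
  1 * suc c + (sum rest + staircase 1 k)                       ≡⟨ rearrange w q v (sum rest) (staircase 1 k) ⟩
  suc (staircase 1 k) + (q * v + sum rest) + w                 ≡⟨ cong (λ z → suc (staircase 1 k) + z + w) split-sum ⟩
  suc (staircase 1 k) + sum bot + w                            ∎
  where
  open ≡-Reasoning
  v : ℕ
  v = suc (suc k)
  q : ℕ
  q = leadingCount v bot
  rest : List ℕ
  rest = dropLeading v bot
  c : ℕ
  c = w + q * v
  ms : List ℕ
  ms = multiplicities k rest
  restored : fromMultiplicities ms ≡ rest
  restored = fromMultiplicities-multiplicities k rest
    (dropLeading-decreasing _ bot d) (dropLeading-all _ bot two) (rest-bounded k bot d bound)
  split-sum : q * v + sum rest ≡ sum bot
  split-sum = begin
    q * v + sum rest                 ≡⟨ cong (_+ sum rest) (sym (sum-replicate q v)) ⟩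
    sum (replicate q v) + sum rest   ≡⟨ sym (sum-++ (replicate q v) rest) ⟩
    sum (replicate q v ++ rest)      ≡⟨ cong sum (leading-split v bot) ⟩
    sum bot                          ∎
  rearrange : ∀ w q v s t → 1 * suc (w + q * v) + (s + t) ≡ suc t + (q * v + s) + w
  rearrange = solve-∀

diagonalSplit : ℕ → List ℕ → List ℕ × List ℕ
diagonalSplit i [] = [] , []
diagonalSplit i (r ∷ rs) with suc i <? r
... | yes _ = (r ∸ suc i ∷ proj₁ (diagonalSplit (suc i) rs)) , proj₂ (diagonalSplit (suc i) rs)
... | no _ = [] , r ∷ rs

diagonalJoin : ℕ → List ℕ → List ℕ → List ℕ
diagonalJoin i [] bot = bot
diagonalJoin i (a ∷ X) bot = a + suc i ∷ diagonalJoin (suc i) X bot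

join-split : ∀ i ρ → diagonalJoin i (proj₁ (diagonalSplit i ρ)) (proj₂ (diagonalSplit i ρ)) ≡ ρ
join-split i [] = refl
join-split i (r ∷ rs) with suc i <? r
... | yes i<r = cong₂ _∷_ (m∸n+n≡m (<⇒≤ i<r)) (join-split (suc i) rs)
... | no _ = refl

head₀-split : ∀ i ρ → proj₁ (diagonalSplit i ρ) ≡ []
  ⊎ head₀ (proj₁ (diagonalSplit i ρ)) + suc i ≡ head₀ ρ
head₀-split i [] = inj₁ refl
head₀-split i (r ∷ rs) with suc i <? r
... | yes i<r = inj₂ (m∸n+n≡m (<⇒≤ i<r))
... | no _ = inj₁ refl

split-strict : ∀ i ρ → Decreasing ρ → Strict (proj₁ (diagonalSplit i ρ))
split-strict i [] d = tt
split-strict i (r ∷ rs) (rs≤r , d) with suc i <? r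
... | no _ = tt
... | yes i<r = next-below (head₀-split (suc i) rs) , split-strict (suc i) rs d
  where
  X′ : List ℕ
  X′ = proj₁ (diagonalSplit (suc i) rs)
  next-below : X′ ≡ [] ⊎ head₀ X′ + suc (suc i) ≡ head₀ rs → head₀ X′ < r ∸ suc i
  next-below (inj₁ e) rewrite e = m<n⇒0<n∸m i<r
  next-below (inj₂ e) = m+n≤o⇒m≤o∸n (suc (head₀ X′))
    (≤-trans (≤-reflexive (trans (sym (+-suc (head₀ X′) (suc i))) e)) rs≤r)

-- The bound on bot is what makes the split unique and what encode needs.
split-bot : ∀ i ρ → Decreasing ρ → All (2 ≤_) ρ →
  let (X , bot) = diagonalSplit i ρ in
  Decreasing bot × All (2 ≤_) bot × All (_≤ suc (i + length X)) bot
split-bot i [] d a = tt , [] , []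
split-bot i (r ∷ rs) d (2≤r ∷ two) with suc i <? r
... | yes _ = let (d′ , two′ , bound) = split-bot (suc i) rs (proj₂ d) two
              in d′ , two′ , All.map (λ q → ≤-trans q (≤-reflexive (cong suc (sym (+-suc i _))))) bound
... | no i≮r = d , 2≤r ∷ two
  , All.map (λ q → ≤-trans q (≤-reflexive (cong suc (sym (+-identityʳ i)))))
      (r≤ ∷ All.map (λ q → ≤-trans q r≤) (decreasing-bounded r rs d))
  where r≤ = ≮⇒≥ i≮r

split-join : ∀ i X bot → Strict X → All (_≤ suc (i + length X)) bot →
  diagonalSplit i (diagonalJoin i X bot) ≡ (X , bot)
split-join i [] [] _ _ = refl
split-join i [] (b ∷ bs) _ (b≤ ∷ _) with suc i <? b
... | yes i<b = ⊥-elim (<-irrefl refl (≤-trans i<b (subst (b ≤_) (cong suc (+-identityʳ i)) b≤)))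
... | no _ = refl
split-join i (a ∷ X) bot (X<a , s) bound with suc i <? (a + suc i)
... | yes _ rewrite m+n∸n≡m a (suc i)
                  | split-join (suc i) X bot s (All.map (λ q → ≤-trans q (≤-reflexive (cong suc (+-suc i _)))) bound)
                  = refl
... | no i≮ = ⊥-elim (i≮ (+-monoˡ-≤ (suc i) (≤-trans (s≤s z≤n) X<a)))

join-partition : ∀ i X bot → Strict X → Decreasing bot → All (2 ≤_) bot →
  All (_≤ suc (i + length X)) bot → Decreasing (diagonalJoin i X bot) × All (2 ≤_) (diagonalJoin i X bot)
join-partition i [] bot _ d two _ = d , two
join-partition i (a ∷ X) bot (X<a , s) d two bound =
  (below-head X X<a bound , proj₁ rest) , two-head ∷ proj₂ rest
  where
  rest : Decreasing (diagonalJoin (suc i) X bot) × All (2 ≤_) (diagonalJoin (suc i) X bot)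
  rest = join-partition (suc i) X bot s d two (All.map (λ q → ≤-trans q (≤-reflexive (cong suc (+-suc i _)))) bound)
  1≤a : 1 ≤ a
  1≤a = ≤-trans (s≤s z≤n) X<a
  two-head : 2 ≤ a + suc i
  two-head = ≤-trans (s≤s (s≤s z≤n)) (+-monoˡ-≤ (suc i) 1≤a)
  below-head : ∀ X → head₀ X < a → All (_≤ suc (i + length (a ∷ X))) bot →
    head₀ (diagonalJoin (suc i) X bot) ≤ a + suc i
  below-head [] _ bound′ =
    ≤-trans (head₀-bounded bot bound′) (≤-trans (≤-reflexive (cong suc (+-comm i 1))) (+-monoˡ-≤ (suc i) 1≤a))
  below-head (a′ ∷ X) a′<a _ = ≤-trans (≤-reflexive (+-suc a′ (suc i))) (+-monoˡ-≤ (suc i) a′<a)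

sum-join : ∀ i X bot → sum (diagonalJoin i X bot) ≡ sum X + staircase i (length X) + sum bot
sum-join i [] bot = refl
sum-join i (a ∷ X) bot rewrite sum-join (suc i) X bot =
  rearrange a i (sum X) (staircase (suc i) (length X)) (sum bot)
  where
  rearrange : ∀ a i s t b → a + suc i + (s + t + b) ≡ a + s + (suc i + t) + b
  rearrange = solve-∀

numLarger-cons : ∀ t x l → numLarger t (x ∷ l) ≤ suc (numLarger t l)
numLarger-cons t x l with t <? x
... | yes t<x rewrite filter-accept (t <?_) {x} {l} t<x = ≤-refl
... | no t≮x rewrite filter-reject (t <?_) {x} {l} t≮x = n≤1+n _

numLarger-join-≤ : ∀ t i X bot → numLarger t (diagonalJoin i X bot) ≤ length X + numLarger t bot
numLarger-join-≤ t i [] bot = ≤-refl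
numLarger-join-≤ t i (a ∷ X) bot =
  ≤-trans (numLarger-cons t (a + suc i) (diagonalJoin (suc i) X bot)) (s≤s (numLarger-join-≤ t (suc i) X bot))

numLarger-bounded : ∀ t bot → All (_≤ t) bot → numLarger t bot ≡ 0
numLarger-bounded t bot a rewrite filter-none (t <?_) (All.map ≤⇒≯ a) = refl

-- The first part a + i + 1 of a diagonal join exceeds j + i + 1 for every
-- j ≤ length X, since a > length X.
join-part-large : ∀ j i a X → Strict (a ∷ X) → j ≤ length X → suc j + i < a + suc i
join-part-large j i a X (X<a , s) j≤X = ≤-trans (≤-reflexive (cong suc (sym (+-suc j i))))
  (+-monoˡ-≤ (suc i) (≤-trans (s≤s j≤X) (≤-trans (s≤s (strict-length X s)) X<a)))

numLarger-join-≥ : ∀ j i X bot → Strict X → j ≤ length X → j ≤ numLarger (j + i) (diagonalJoin i X bot)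
numLarger-join-≥ zero i X bot s p = z≤n
numLarger-join-≥ (suc j) i (a ∷ X) bot (X<a , s) (s≤s j≤X)
  rewrite filter-accept ((suc j + i) <?_) {a + suc i} {diagonalJoin (suc i) X bot}
            (join-part-large j i a X (X<a , s) j≤X) =
  s≤s (subst (λ z → j ≤ numLarger z (diagonalJoin (suc i) X bot)) (+-suc j i)
    (numLarger-join-≥ j (suc i) X bot s j≤X))

crankWith : ℕ → List ℕ → ℤ.ℤ
crankWith zero π = ℤ.+ largestPart π
crankWith (suc w) π = ℤ.+ numLarger (suc w) π ℤ.- ℤ.+ suc w

crank-with : ∀ π → crank π ≡ crankWith (numOnes π) π
crank-with π with numOnes π
... | zero = refl
... | suc w = refl

numLarger-append-ones : ∀ t l w → 1 ≤ t → numLarger t (l ++ replicate w 1) ≡ numLarger t l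
numLarger-append-ones t l w 1≤t
  rewrite filter-++ (t <?_) l (replicate w 1)
        | filter-none (t <?_) (All.replicate⁺ w (≤⇒≯ 1≤t))
        | ++-identityʳ (filter (t <?_) l) = refl

-- A diagonal join followed by w ones has non-negative crank exactly when w ≤ length X:
-- the parts larger than w are then the first w parts of the join.
crank-nonnegative⇒ : ∀ w X bot → All (_≤ suc (length X)) bot →
  ℤ.+ 0 ℤ.≤ crankWith w (diagonalJoin 0 X bot ++ replicate w 1) → w ≤ length X
crank-nonnegative⇒ zero X bot _ _ = z≤n
crank-nonnegative⇒ (suc w) X bot bound nonneg with suc w ≤? length X
... | yes w<X = w<X
... | no w≮X = ⊥-elim (<-irrefl refl (begin-strict
  length X                                           <⟨ s≤s X≤w ⟩
  suc w                                              ≤⟨ many-large ⟩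
  numLarger (suc w) (diagonalJoin 0 X bot)           ≤⟨ numLarger-join-≤ (suc w) 0 X bot ⟩
  length X + numLarger (suc w) bot                   ≡⟨ cong (length X +_) (numLarger-bounded (suc w) bot
                                                          (All.map (λ q → ≤-trans q (s≤s X≤w)) bound)) ⟩
  length X + 0                                       ≡⟨ +-identityʳ _ ⟩
  length X                                           ∎))
  where
  open ≤-Reasoning
  X≤w : length X ≤ w
  X≤w = ≤-pred (≰⇒> w≮X)
  many-large : suc w ≤ numLarger (suc w) (diagonalJoin 0 X bot)
  many-large = subst (suc w ≤_) (numLarger-append-ones (suc w) (diagonalJoin 0 X bot) (suc w) (s≤s z≤n))
    (ℤ.drop‿+≤+ (ℤ.0≤i-j⇒j≤i nonneg))

crank-nonnegative⇐ : ∀ w X bot → Strict X → w ≤ length X →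
  ℤ.+ 0 ℤ.≤ crankWith w (diagonalJoin 0 X bot ++ replicate w 1)
crank-nonnegative⇐ zero X bot _ _ = ℤ.+≤+ z≤n
crank-nonnegative⇐ (suc w) X bot s w≤X
  rewrite numLarger-append-ones (suc w) (diagonalJoin 0 X bot) (suc w) (s≤s z≤n) =
  ℤ.i≤j⇒0≤j-i (ℤ.+≤+ (subst (λ t → suc w ≤ numLarger t (diagonalJoin 0 X bot)) (+-identityʳ (suc w))
    (numLarger-join-≥ (suc w) 0 X bot s w≤X)))

nonOnes : List ℕ → List ℕ
nonOnes [] = []
nonOnes (x ∷ xs) with x ≟ 1
... | yes _ = nonOnes xs
... | no _ = x ∷ nonOnes xs

nonOnes-ones : ∀ xs → All (_≡ 1) xs → nonOnes xs ≡ []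
nonOnes-ones [] _ = refl
nonOnes-ones (x ∷ xs) (x≡1 ∷ ps) with x ≟ 1
... | yes _ = nonOnes-ones xs ps
... | no x≢1 = ⊥-elim (x≢1 x≡1)

nonOnes-split : ∀ π → Decreasing π → All (1 ≤_) π → nonOnes π ++ replicate (numOnes π) 1 ≡ π
nonOnes-split [] _ _ = refl
nonOnes-split (x ∷ xs) (xs≤x , d) (_ ∷ pos) with x ≟ 1
... | yes refl rewrite filter-accept (_≟ 1) {1} {xs} refl =
  trans (cong (_++ 1 ∷ replicate (numOnes xs) 1) only-ones) (cong (1 ∷_) ones)
  where
  only-ones : nonOnes xs ≡ []
  only-ones = nonOnes-ones xs (All.zipWith (λ (p , q) → ≤-antisym p q) (decreasing-bounded 1 xs (xs≤x , d) , pos))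
  ones : replicate (numOnes xs) 1 ≡ xs
  ones = trans (cong (_++ replicate (numOnes xs) 1) (sym only-ones)) (nonOnes-split xs d pos)
... | no x≢1 rewrite filter-reject (_≟ 1) {x} {xs} x≢1 = cong (x ∷_) (nonOnes-split xs d pos)

nonOnes-append : ∀ ρ w → All (2 ≤_) ρ → nonOnes (ρ ++ replicate w 1) ≡ ρ
nonOnes-append [] zero _ = refl
nonOnes-append [] (suc w) _ = nonOnes-append [] w []
nonOnes-append (x ∷ ρ) w (2≤x ∷ two) with x ≟ 1
... | yes refl = ⊥-elim (<-irrefl refl 2≤x)
... | no _ = cong (x ∷_) (nonOnes-append ρ w two)

numOnes-append : ∀ ρ w → All (2 ≤_) ρ → numOnes (ρ ++ replicate w 1) ≡ w
numOnes-append [] zero _ = refl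
numOnes-append [] (suc w) _ rewrite filter-accept (_≟ 1) {1} {replicate w 1} refl = cong suc (numOnes-append [] w [])
numOnes-append (x ∷ ρ) w (2≤x ∷ two)
  rewrite filter-reject (_≟ 1) {x} {ρ ++ replicate w 1} (λ e → <-irrefl (sym e) 2≤x) = numOnes-append ρ w two

nonOnes-≥2 : ∀ π → All (1 ≤_) π → All (2 ≤_) (nonOnes π)
nonOnes-≥2 [] _ = []
nonOnes-≥2 (x ∷ xs) (1≤x ∷ pos) with x ≟ 1
... | yes _ = nonOnes-≥2 xs pos
... | no x≢1 = ≤∧≢⇒< 1≤x (λ e → x≢1 (sym e)) ∷ nonOnes-≥2 xs pos

decreasing-++ˡ : ∀ l₁ l₂ → Decreasing (l₁ ++ l₂) → Decreasing l₁
decreasing-++ˡ [] l₂ _ = tt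
decreasing-++ˡ (a ∷ []) l₂ _ = z≤n , tt
decreasing-++ˡ (a ∷ b ∷ l₁) l₂ (b≤a , d) = b≤a , decreasing-++ˡ (b ∷ l₁) l₂ d

decreasing-append-ones : ∀ ρ w → Decreasing ρ → All (1 ≤_) ρ → Decreasing (ρ ++ replicate w 1)
decreasing-append-ones [] zero _ _ = tt
decreasing-append-ones [] (suc zero) _ _ = z≤n , tt
decreasing-append-ones [] (suc (suc w)) _ _ = ≤-refl , decreasing-append-ones [] (suc w) tt []
decreasing-append-ones (a ∷ []) zero _ _ = z≤n , tt
decreasing-append-ones (a ∷ []) (suc w) _ (1≤a ∷ _) = 1≤a , decreasing-append-ones [] (suc w) tt []
decreasing-append-ones (a ∷ b ∷ ρ) w (b≤a , d) (_ ∷ pos) = b≤a , decreasing-append-ones (b ∷ ρ) w d pos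

sum-append-ones : ∀ ρ w → sum (ρ ++ replicate w 1) ≡ sum ρ + w
sum-append-ones ρ w = trans (sum-++ ρ (replicate w 1)) (cong (sum ρ +_) (trans (sum-replicate w 1) (*-identityʳ w)))

pairOf : List ℕ → List ℕ → ℕ → List ℕ × List ℕ
pairOf X bot w = interlace X (ungaps (encode (length X) bot w))

pairOfSplit : List ℕ → ℕ → List ℕ × List ℕ
pairOfSplit ρ w = pairOf (proj₁ (diagonalSplit 0 ρ)) (proj₂ (diagonalSplit 0 ρ)) w

toPair : List ℕ → List ℕ × List ℕ
toPair π = pairOfSplit (nonOnes π) (numOnes π)

partitionOf : List ℕ → List ℕ × ℕ → List ℕ
partitionOf X (bot , w) = diagonalJoin 0 X bot ++ replicate w 1

fromPair : List ℕ × List ℕ → List ℕ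
fromPair (l , t) =
  let (X , Y) = deinterlace l t
  in partitionOf X (decode (length X) (gaps Y))

NonnegativeCrank : List ℕ → Set
NonnegativeCrank π = IsPartition π × (ℤ.+ 0 ℤ.≤ crank π)

length-ungaps-encode : ∀ (X bot : List ℕ) w → length (ungaps (encode (length X) bot w)) ≡ length X
length-ungaps-encode X bot w = trans (length-ungaps (encode (length X) bot w)) (length-encode (length X) bot w)

record Decomposition (π : List ℕ) : Set where
  field
    X bot : List ℕ
    w : ℕ
    pair-eq : toPair π ≡ pairOf X bot w
    partition-eq : π ≡ partitionOf X (bot , w)
    strict-X : Strict X
    encodable : Encodable (length X) bot w

decompose : ∀ π → NonnegativeCrank π → Decomposition π
decompose π ((pos , linked) , nonneg) = record
  { X = X ; bot = bot ; w = w ; pair-eq = refl ; partition-eq = π-eq ; strict-X = strict-X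
  ; encodable = decreasing-bot , two-bot , bound-bot , w≤X }
  where
  d : Decreasing π
  d = linked⇒decreasing linked
  ρ : List ℕ
  ρ = nonOnes π
  w : ℕ
  w = numOnes π
  X : List ℕ
  X = proj₁ (diagonalSplit 0 ρ)
  bot : List ℕ
  bot = proj₂ (diagonalSplit 0 ρ)
  ρ-ones : ρ ++ replicate w 1 ≡ π
  ρ-ones = nonOnes-split π d pos
  decreasing-ρ : Decreasing ρ
  decreasing-ρ = decreasing-++ˡ ρ (replicate w 1) (subst Decreasing (sym ρ-ones) d)
  π-eq : π ≡ partitionOf X (bot , w)
  π-eq = trans (sym ρ-ones) (cong (_++ replicate w 1) (sym (join-split 0 ρ)))
  strict-X : Strict X
  strict-X = split-strict 0 ρ decreasing-ρ
  bot-facts : Decreasing bot × All (2 ≤_) bot × All (_≤ suc (length X)) bot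
  bot-facts = split-bot 0 ρ decreasing-ρ (nonOnes-≥2 π pos)
  decreasing-bot : Decreasing bot
  decreasing-bot = proj₁ bot-facts
  two-bot : All (2 ≤_) bot
  two-bot = proj₁ (proj₂ bot-facts)
  bound-bot : All (_≤ suc (length X)) bot
  bound-bot = proj₂ (proj₂ bot-facts)
  w≤X : w ≤ length X
  w≤X = crank-nonnegative⇒ w X bot bound-bot
    (subst (ℤ.+ 0 ℤ.≤_) (trans (crank-with π) (cong (crankWith w) π-eq)) nonneg)

toPair-interlaces : ∀ π → NonnegativeCrank π →
  Interlaces (proj₁ (toPair π)) (proj₂ (toPair π)) × sum (proj₁ (toPair π)) ≡ sum π
toPair-interlaces π valid rewrite Decomposition.pair-eq (decompose π valid) =
  interlace-interlaces X Y (sym (length-ungaps-encode X bot w)) strict-X (strict-ungaps _) , size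
  where
  open Decomposition (decompose π valid)
  Y : List ℕ
  Y = ungaps (encode (length X) bot w)
  size : sum (proj₁ (interlace X Y)) ≡ sum π
  size = begin
    sum (proj₁ (interlace X Y))                         ≡⟨ sum-interlace X Y (sym (length-ungaps-encode X bot w)) ⟩
    sum X + sum Y                                       ≡⟨ cong (sum X +_) (sum-ungaps-encode (length X) bot w encodable) ⟩
    sum X + (staircase 0 (length X) + sum bot + w)      ≡⟨ rearrange (sum X) (staircase 0 (length X)) (sum bot) w ⟩
    sum X + staircase 0 (length X) + sum bot + w        ≡⟨ cong (_+ w) (sym (sum-join 0 X bot)) ⟩
    sum (diagonalJoin 0 X bot) + w                      ≡⟨ sym (sum-append-ones (diagonalJoin 0 X bot) w) ⟩
    sum (partitionOf X (bot , w))                       ≡⟨ cong sum (sym partition-eq) ⟩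
    sum π                                               ∎
    where
    open ≡-Reasoning
    rearrange : ∀ a b c d → a + (b + c + d) ≡ a + b + c + d
    rearrange = solve-∀

fromPair-toPair : ∀ π → NonnegativeCrank π → fromPair (toPair π) ≡ π
fromPair-toPair π valid rewrite Decomposition.pair-eq (decompose π valid) = begin
  fromPair (interlace X Y)
    ≡⟨ cong (λ (X′ , Y′) → partitionOf X′ (decode (length X′) (gaps Y′)))
            (deinterlace-interlace X Y (sym (length-ungaps-encode X bot w))) ⟩
  partitionOf X (decode (length X) (gaps Y))
    ≡⟨ cong (λ y → partitionOf X (decode (length X) y)) (gaps-ungaps (encode (length X) bot w)) ⟩
  partitionOf X (decode (length X) (encode (length X) bot w))
    ≡⟨ cong (partitionOf X) (decode-encode (length X) bot w encodable) ⟩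
  partitionOf X (bot , w)
    ≡⟨ sym partition-eq ⟩
  π ∎
  where
  open Decomposition (decompose π valid)
  open ≡-Reasoning
  Y : List ℕ
  Y = ungaps (encode (length X) bot w)

module Recovered (l t : List ℕ) (it : Interlaces l t) where
  open Deinterlaced (deinterlace-correct l t it) public
  X : List ℕ
  X = proj₁ (deinterlace l t)
  Y : List ℕ
  Y = proj₂ (deinterlace l t)
  k : ℕ
  k = length X
  y : List ℕ
  y = gaps Y
  length-y : length y ≡ k
  length-y = trans (length-gaps Y) (trans length-Y (sym length-X))
  bot : List ℕ
  bot = proj₁ (decode k y)
  w : ℕ
  w = proj₂ (decode k y)
  encodable : Encodable k bot w
  encodable = decode-encodable k y length-y
  bound-bot : All (_≤ suc k) bot
  bound-bot = proj₁ (proj₂ (proj₂ encodable))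
  J : List ℕ
  J = diagonalJoin 0 X bot
  J-partition : Decreasing J × All (2 ≤_) J
  J-partition = join-partition 0 X bot strict-X (proj₁ encodable) (proj₁ (proj₂ encodable)) bound-bot
  J-positive : All (1 ≤_) J
  J-positive = All.map (≤-trans (s≤s z≤n)) (proj₂ J-partition)
  Y-eq : ungaps (encode k bot w) ≡ Y
  Y-eq = trans (cong ungaps (encode-decode k y length-y)) (ungaps-gaps Y strict-Y)

fromPair-valid : ∀ l t → Interlaces l t → NonnegativeCrank (fromPair (l , t)) × sum (fromPair (l , t)) ≡ sum l
fromPair-valid l t it =
  ((All.++⁺ J-positive (All.replicate⁺ w (s≤s z≤n))
   , decreasing⇒linked (J ++ replicate w 1) (decreasing-append-ones J w (proj₁ J-partition) J-positive))
  , nonneg) , size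
  where
  open Recovered l t it
  nonneg : ℤ.+ 0 ℤ.≤ crank (J ++ replicate w 1)
  nonneg = subst (ℤ.+ 0 ℤ.≤_)
    (sym (trans (crank-with (J ++ replicate w 1)) (cong (λ v → crankWith v (J ++ replicate w 1)) (numOnes-append J w (proj₂ J-partition)))))
    (crank-nonnegative⇐ w X bot strict-X (proj₂ (proj₂ (proj₂ encodable))))
  size : sum (J ++ replicate w 1) ≡ sum l
  size = begin
    sum (J ++ replicate w 1)                   ≡⟨ sum-append-ones J w ⟩
    sum J + w                                  ≡⟨ cong (_+ w) (sum-join 0 X bot) ⟩
    sum X + staircase 0 k + sum bot + w        ≡⟨ rearrange (sum X) (staircase 0 k) (sum bot) w ⟩
    sum X + (staircase 0 k + sum bot + w)      ≡⟨ cong (sum X +_) (sym (sum-ungaps-encode k bot w encodable)) ⟩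
    sum X + sum (ungaps (encode k bot w))      ≡⟨ cong (λ Y′ → sum X + sum Y′) Y-eq ⟩
    sum X + sum Y                              ≡⟨ sym (sum-interlace X Y (trans length-X (sym length-Y))) ⟩
    sum (proj₁ (interlace X Y))                ≡⟨ cong (λ p → sum (proj₁ p)) interlace-deinterlace ⟩
    sum l                                      ∎
    where
    open ≡-Reasoning
    rearrange : ∀ a b c d → a + b + c + d ≡ a + (b + c + d)
    rearrange = solve-∀

toPair-fromPair : ∀ l t → Interlaces l t → toPair (fromPair (l , t)) ≡ (l , t)
toPair-fromPair l t it = begin
  pairOfSplit (nonOnes (J ++ replicate w 1)) (numOnes (J ++ replicate w 1))
    ≡⟨ cong₂ pairOfSplit (nonOnes-append J w (proj₂ J-partition)) (numOnes-append J w (proj₂ J-partition)) ⟩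
  pairOfSplit J w
    ≡⟨ cong (λ (X′ , bot′) → pairOf X′ bot′ w) (split-join 0 X bot strict-X bound-bot) ⟩
  interlace X (ungaps (encode k bot w))
    ≡⟨ cong (interlace X) Y-eq ⟩
  interlace X Y
    ≡⟨ interlace-deinterlace ⟩
  (l , t) ∎
  where
  open Recovered l t it
  open ≡-Reasoning

-- Both sides of the identity count the interlacing pairs (l, t) with |l| = n:
-- via l ∈ RR₂ and its ω₂,₂(l) interlacings, and via the bijection with B.
InterlacingPair : ℕ → List ℕ × List ℕ → Set
InterlacingPair n (l , t) = Interlaces l t × sum l ≡ n

enumerate-by-RR2 : ∀ n (A : List (List ℕ)) → (∀ π → (π ∈ A) ⇔ (IsRR2 π × sum π ≡ n)) →
  ∀ {z} → (z ∈ sigmaList A interlacings) ⇔ InterlacingPair n z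
enumerate-by-RR2 n A hA {l , t} = mk⇔
  (λ p → let (l∈A , t∈) = ∈-sigmaList⁻ A p
         in ∈-interlacings⁻ l t∈ , proj₂ (Equivalence.to (hA l) l∈A))
  (λ (it , size) → ∈-sigmaList⁺ (Equivalence.from (hA l) (interlaces⇒RR2 l t it , size))
                                 (∈-interlacings⁺ l t it))

enumerate-by-crank : ∀ n (B : List (List ℕ)) →
  (∀ π → (π ∈ B) ⇔ (IsPartition π × (ℤ.+ 0 ℤ.≤ crank π) × sum π ≡ n)) →
  ∀ {z} → (z ∈ map toPair B) ⇔ InterlacingPair n z
enumerate-by-crank n B hB {l , t} = mk⇔ forward backward
  where
  forward : (l , t) ∈ map toPair B → InterlacingPair n (l , t)
  forward p with ∈-map⁻ toPair p
  ... | π , π∈B , refl with Equivalence.to (hB π) π∈B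
  ...   | partition , nonneg , size with toPair-interlaces π (partition , nonneg)
  ...     | it , size′ = it , trans size′ size
  backward : InterlacingPair n (l , t) → (l , t) ∈ map toPair B
  backward (it , size) with fromPair-valid l t it
  ... | (partition , nonneg) , size′ =
    subst (_∈ map toPair B) (toPair-fromPair l t it)
      (∈-map⁺ toPair (Equivalence.from (hB (fromPair (l , t))) (partition , nonneg , trans size′ size)))

unique-toPair : ∀ (B : List (List ℕ)) → Unique B → (∀ {π} → π ∈ B → NonnegativeCrank π) →
  Unique (map toPair B)
unique-toPair B uB valid = Unique.map⁻ (subst Unique (sym round-trip) uB)
  where
  round-trip : map fromPair (map toPair B) ≡ B
  round-trip = trans (sym (map-∘ B)) (map-id-local (All.tabulate (λ p → fromPair-toPair _ (valid p))))

theorem7 : (n : ℕ) (A B : List (List ℕ)) →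
    Unique A → (∀ π → (π ∈ A) ⇔ (IsRR2 π × sum π ≡ n)) →
    Unique B → (∀ π → (π ∈ B) ⇔ (IsPartition π × (ℤ.+ 0 ℤ.≤ crank π) × sum π ≡ n)) →
    sum (map ω22 A) ≡ length B
theorem7 n A B uA hA uB hB = begin
  sum (map ω22 A)                                   ≡⟨ cong sum (sym (map-cong length-interlacings A)) ⟩
  sum (map (λ l → length (interlacings l)) A)       ≡⟨ sym (length-sigmaList A interlacings) ⟩
  length (sigmaList A interlacings)                 ≡⟨ unique-enumerations-length
                                                         (unique-sigmaList uA unique-interlacings)
                                                         (unique-toPair B uB valid) same-members ⟩
  length (map toPair B)                             ≡⟨ length-map toPair B ⟩
  length B                                          ∎
  where
  open ≡-Reasoning
  valid : ∀ {π} → π ∈ B → NonnegativeCrank π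
  valid {π} p = let (partition , nonneg , _) = Equivalence.to (hB π) p in partition , nonneg
  same-members : ∀ {z} → (z ∈ sigmaList A interlacings) ⇔ (z ∈ map toPair B)
  same-members = mk⇔ (Equivalence.from (enumerate-by-crank n B hB) ∘ Equivalence.to (enumerate-by-RR2 n A hA))
                     (Equivalence.from (enumerate-by-RR2 n A hA) ∘ Equivalence.to (enumerate-by-crank n B hB))
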